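{- Let $G$ be a graph with $p$ vertices and $q$ edges that satisfies $bs(G) \le m$, where $m$ is a nonnegative integer. Let $0 < \lambda < 1$ and suppose that the minimum degree satisfies $\delta(G) \ge \lambda p$ (so $q \ge \lambda p^2/2$). If $p > 5(2\lambda+1)/\lambda^2$, then \[ M_G(C_4) > \left( \frac{\lambda^3 p^2}{5} - \frac{m^2}{2} \right) q. \]
   Context: For a graph $G$, the book size $bs(G)$ is the largest $k$ such that $G$ contains the book $B_k$ (the graph consisting of $k$ triangles sharing a common edge); equivalently, the maximum over edges $uv$ of $G$ of the number of common neighbors of $u$ and $v$. For graphs $G$ and $H$, $M_G(H)$ denotes the number of induced subgraphs of $G$ isomorphic to $H$; $C_4$ is the cycle on four vertices.
   Formalization: The parameter λ takes only rational values. -}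

module Defs where

open import Data.Nat using (ℕ; _⊔_; _<ᵇ_)
open import Data.Bool using (Bool; true; false; _∧_; _∨_; not; if_then_else_)
open import Data.Fin using (Fin; toℕ)
open import Data.List using (List; allFin; map; foldr; concatMap)
open import Data.Nat.ListAction using (sum)
open import Data.Integer using (+_)
open import Data.Rational using (ℚ; _/_)
open import Relation.Binary.PropositionalEquality using (_≡_)

record Graph (p : ℕ) : Set where
  field
    adj    : Fin p → Fin p → Bool
    sym    : ∀ i j → adj i j ≡ adj j i
    irrefl : ∀ i → adj i i ≡ false
open Graph public

count : ∀ {n} → (Fin n → Bool) → ℕ
count {n} f = sum (map (λ i → if f i then 1 else 0) (allFin n))

_<F_ : ∀ {n} → Fin n → Fin n → Bool
i <F j = toℕ i <ᵇ toℕ j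

edges : ∀ {p} → Graph p → ℕ
edges {p} G = sum (map (λ i → count (λ j → (i <F j) ∧ adj G i j)) (allFin p))

degree : ∀ {p} → Graph p → Fin p → ℕ
degree G v = count (adj G v)

common : ∀ {p} → Graph p → Fin p → Fin p → ℕ
common G u v = count (λ w → adj G u w ∧ adj G w v)

-- book size bs(G): maximum over edges uv of the number of common neighbours
-- (0 if G has no edges)
bs : ∀ {p} → Graph p → ℕ
bs {p} G = foldr _⊔_ 0
  (concatMap (λ u → map (λ v → if adj G u v then common G u v else 0) (allFin p)) (allFin p))

-- A 4-cycle on four labelled
-- vertices is one of the three cyclic orders (a b c d), (a b d c), (a c b d):
-- the four consecutive pairs are edges and the two diagonals are non-edges.
cyc : ∀ {p} → Graph p → Fin p → Fin p → Fin p → Fin p → Bool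
cyc G w x y z = adj G w x ∧ adj G x y ∧ adj G y z ∧ adj G z w
              ∧ not (adj G w y) ∧ not (adj G x z)

inducesC4 : ∀ {p} → Graph p → Fin p → Fin p → Fin p → Fin p → Bool
inducesC4 G a b c d = cyc G a b c d ∨ cyc G a b d c ∨ cyc G a c b d

M-C4 : ∀ {p} → Graph p → ℕ
M-C4 {p} G = sum (map (λ a → sum (map (λ b → sum (map (λ c →
  count (λ d → (a <F b) ∧ (b <F c) ∧ (c <F d) ∧ inducesC4 G a b c d))
  (allFin p))) (allFin p))) (allFin p))

ℕ→ℚ : ℕ → ℚ
ℕ→ℚ n = (+ n) / 1

{-# OPTIONS --safe #-}
module Submission where

-- Let c(u,y) be the number of common neighbours of u and y, S = Σ_{u≠y} c(u,y) and
-- Q = Σ_{u≠y} c(u,y)². Then Q − S counts the closed walks u v y x u with u ≠ y and v ≠ x.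
-- Such a walk is an induced 4-cycle unless uy or vx is an edge, and every induced C4 is
-- traversed by 8 of them; a walk with chord uy is an ordered pair of common neighbours of
-- the edge uy, of which there are at most m². Hence Q − S ≤ 8 M_G(C4) + 4qm². On the other
-- hand S = Σ_v d(v)² − 2q ≥ 2q(λp − 1) by the degree bound and Q ≥ S²/p² by Cauchy–Schwarz;
-- the hypothesis on p makes S²/p² − S exceed 8λ³p²q/5.

open import Defs renaming (sym to adj-sym)
open import Data.Fin using (Fin; toℕ; zero; suc)
open import Data.Nat using (ℕ)
open import Function using (_∘_; _∘′_; id)
open import Relation.Binary.PropositionalEquality

module FiniteSums where

  open import Data.Bool using (Bool; true; false; _∧_; _∨_; not; if_then_else_; T)
  import Data.List as List using (List; tabulate; map; allFin; foldr; _∷_)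
  open import Data.List.Properties using (map-tabulate)
  open import Data.List.Membership.Propositional using (_∈_)
  open import Data.List.Relation.Unary.Any using (here; there)
  import Data.Nat.ListAction as List using (sum)
  open import Data.Unit using (tt)
  open import Data.Empty using (⊥-elim)
  open import Data.Nat using (zero; suc; _+_; _*_; _≤_; _<ᵇ_; _≡ᵇ_; _⊔_; z≤n; s≤s)
  open import Data.Nat.Properties
  open import Data.Nat.Tactic.RingSolver using (solve-∀)
  open import Algebra.Properties.Semiring.Sum +-*-semiring
    using (sum; sum-syntax; sum-cong-≗; ∑-distrib-+; ∑-comm; *-distribˡ-sum; *-distribʳ-sum; sum-replicate-zero)

  𝟙 : Bool → ℕ
  𝟙 b = if b then 1 else 0

  𝟙-∧ : ∀ a b → 𝟙 (a ∧ b) ≡ 𝟙 a * 𝟙 b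
  𝟙-∧ true  b = sym (+-identityʳ (𝟙 b))
  𝟙-∧ false b = refl

  𝟙-idem : ∀ b → 𝟙 b * 𝟙 b ≡ 𝟙 b
  𝟙-idem true  = refl
  𝟙-idem false = refl

  𝟙-∨³ : ∀ a b c → 𝟙 a * 𝟙 b ≡ 0 → 𝟙 a * 𝟙 c ≡ 0 → 𝟙 b * 𝟙 c ≡ 0 → 𝟙 (a ∨ b ∨ c) ≡ 𝟙 a + 𝟙 b + 𝟙 c
  𝟙-∨³ true  true  _     () _  _
  𝟙-∨³ true  false true  _  () _
  𝟙-∨³ true  false false _  _  _  = refl
  𝟙-∨³ false true  true  _  _  ()
  𝟙-∨³ false true  false _  _  _  = refl
  𝟙-∨³ false false c     _  _  _  = refl

  n≤1⇒n*n≡n : ∀ {n} → n ≤ 1 → n * n ≡ n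
  n≤1⇒n*n≡n z≤n       = refl
  n≤1⇒n*n≡n (s≤s z≤n) = refl

  w*n₁*n₂≤w*1 : ∀ w {n₁ n₂} → n₁ ≤ 1 → n₂ ≤ 1 → w * n₁ * n₂ ≤ w * 1
  w*n₁*n₂≤w*1 w {n₁} {n₂} n₁≤1 n₂≤1 = subst (w * n₁ * n₂ ≤_) (*-identityʳ (w * 1)) (*-mono-≤ (*-monoʳ-≤ w n₁≤1) n₂≤1)

  ≤-split-chords : ∀ w b c {n₁ n₂} → n₁ ≤ 1 → n₂ ≤ 1 →
                   w * n₁ * n₂ ≤ w * (𝟙 (not b) * 𝟙 (not c)) * n₁ * n₂ + w * 𝟙 b + w * 𝟙 c
  ≤-split-chords w false false {n₁} {n₂} _ _ = ≤-reflexive (no-chord w n₁ n₂)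
    where
    no-chord : ∀ w n₁ n₂ → w * n₁ * n₂ ≡ w * (1 * 1) * n₁ * n₂ + w * 0 + w * 0
    no-chord = solve-∀
  ≤-split-chords w true  c     n₁≤1 n₂≤1 =
    ≤-trans (w*n₁*n₂≤w*1 w n₁≤1 n₂≤1) (≤-trans (m≤n+m (w * 1) _) (m≤m+n _ (w * 𝟙 c)))
  ≤-split-chords w false true  n₁≤1 n₂≤1 = ≤-trans (w*n₁*n₂≤w*1 w n₁≤1 n₂≤1) (m≤n+m (w * 1) _)

  sum-tabulate : ∀ {n} (f : Fin n → ℕ) → List.sum (List.tabulate f) ≡ ∑[ i < n ] f i
  sum-tabulate {zero}  f = refl
  sum-tabulate {suc n} f = cong (f zero +_) (sum-tabulate (f ∘ suc))

  sum-map-allFin : ∀ {n} (f : Fin n → ℕ) → List.sum (List.map f (List.allFin n)) ≡ ∑[ i < n ] f i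
  sum-map-allFin f = trans (cong List.sum (map-tabulate id f)) (sum-tabulate f)

  sum-map-allFin-≗ : ∀ {n} {f g : Fin n → ℕ} → (∀ i → f i ≡ g i) → List.sum (List.map f (List.allFin n)) ≡ ∑[ i < n ] g i
  sum-map-allFin-≗ {f = f} f≗g = trans (sum-map-allFin f) (sum-cong-≗ f≗g)

  ∈⇒≤foldr-⊔ : ∀ {x : ℕ} {xs : List.List ℕ} → x ∈ xs → x ≤ List.foldr _⊔_ 0 xs
  ∈⇒≤foldr-⊔ {x} {y List.∷ ys} (here refl)  = m≤m⊔n x (List.foldr _⊔_ 0 ys)
  ∈⇒≤foldr-⊔ {x} {y List.∷ ys} (there x∈ys) = ≤-trans (∈⇒≤foldr-⊔ x∈ys) (m≤n⊔m y (List.foldr _⊔_ 0 ys))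

  ∑-mono-≤ : ∀ {n} {f g : Fin n → ℕ} → (∀ i → f i ≤ g i) → sum f ≤ sum g
  ∑-mono-≤ {zero}  f≤g = z≤n
  ∑-mono-≤ {suc n} f≤g = +-mono-≤ (f≤g zero) (∑-mono-≤ (f≤g ∘ suc))

  ∑-const : ∀ n c → ∑[ i < n ] c ≡ n * c
  ∑-const zero    c = refl
  ∑-const (suc n) c = cong (c +_) (∑-const n c)

  ∑²-distrib-+ : ∀ {m n} (f g : Fin m → Fin n → ℕ) →
                 ∑[ i < m ] ∑[ j < n ] (f i j + g i j) ≡ ∑[ i < m ] ∑[ j < n ] f i j + ∑[ i < m ] ∑[ j < n ] g i j
  ∑²-distrib-+ {m} {n} f g = trans (sum-cong-≗ λ i → ∑-distrib-+ (f i) (g i))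
                                    (∑-distrib-+ (λ i → ∑[ j < n ] f i j) (λ i → ∑[ j < n ] g i j))

  ∑*∑ : ∀ {m n} (f : Fin m → ℕ) (g : Fin n → ℕ) → sum f * sum g ≡ ∑[ i < m ] ∑[ j < n ] (f i * g j)
  ∑*∑ f g = trans (*-distribʳ-sum (sum g) f) (sum-cong-≗ λ i → *-distribˡ-sum (f i) g)

  ∑²-scaled-product : ∀ {m n} c (f : Fin m → ℕ) (g : Fin n → ℕ) →
                      ∑[ i < m ] ∑[ j < n ] (c * (f i * g j)) ≡ c * (sum f * sum g)
  ∑²-scaled-product {m} {n} c f g =
    trans (sum-cong-≗ λ i → sym (*-distribˡ-sum c (λ j → f i * g j)))
          (trans (sym (*-distribˡ-sum c λ i → ∑[ j < n ] (f i * g j))) (cong (c *_) (sym (∑*∑ f g))))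

  2ab≤a²+b² : ∀ a b → 2 * (a * b) ≤ a * a + b * b
  2ab≤a²+b² zero    b       = z≤n
  2ab≤a²+b² (suc a) zero    = subst (_≤ suc a * suc a + 0) (sym (cong (2 *_) (*-zeroʳ (suc a)))) z≤n
  2ab≤a²+b² (suc a) (suc b) = subst₂ _≤_ (lhs a b) (rhs a b) (+-monoˡ-≤ (2 * a + 2 * b + 2) (2ab≤a²+b² a b))
    where
    lhs : ∀ a b → 2 * (a * b) + (2 * a + 2 * b + 2) ≡ 2 * (suc a * suc b)
    lhs = solve-∀
    rhs : ∀ a b → a * a + b * b + (2 * a + 2 * b + 2) ≡ suc a * suc a + suc b * suc b
    rhs = solve-∀

  cauchy-schwarz : ∀ {n} (f : Fin n → ℕ) → sum f * sum f ≤ n * ∑[ i < n ] (f i * f i)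
  cauchy-schwarz {zero}  f = z≤n
  cauchy-schwarz {suc n} f = begin
    (a + s) * (a + s)                        ≡⟨ expand a s ⟩
    a * a + 2 * (a * s) + s * s              ≤⟨ +-mono-≤ (+-monoʳ-≤ (a * a) cross) (cauchy-schwarz (f ∘ suc)) ⟩
    a * a + (q + n * (a * a)) + n * q        ≡⟨ collect a q n ⟩
    suc n * (a * a + q)                      ∎
    where
    open ≤-Reasoning
    a = f zero
    s = sum (f ∘ suc)
    q = ∑[ i < n ] (f (suc i) * f (suc i))
    cross : 2 * (a * s) ≤ q + n * (a * a)
    cross = begin
      2 * (a * s)                                 ≡⟨ cong (2 *_) (*-distribˡ-sum a (f ∘ suc)) ⟩
      2 * ∑[ i < n ] (a * f (suc i))              ≡⟨ *-distribˡ-sum 2 (λ i → a * f (suc i)) ⟩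
      ∑[ i < n ] (2 * (a * f (suc i)))            ≤⟨ ∑-mono-≤ (λ i → subst (2 * (a * f (suc i)) ≤_) (+-comm (a * a) _)
                                                                           (2ab≤a²+b² a (f (suc i)))) ⟩
      ∑[ i < n ] (f (suc i) * f (suc i) + a * a)  ≡⟨ ∑-distrib-+ (λ i → f (suc i) * f (suc i)) (λ _ → a * a) ⟩
      q + ∑[ i < n ] (a * a)                      ≡⟨ cong (q +_) (∑-const n (a * a)) ⟩
      q + n * (a * a)                             ∎
    expand : ∀ a s → (a + s) * (a + s) ≡ a * a + 2 * (a * s) + s * s
    expand = solve-∀
    collect : ∀ a q n → a * a + (q + n * (a * a)) + n * q ≡ suc n * (a * a + q)
    collect = solve-∀

  lt eq ne : ∀ {n} → Fin n → Fin n → ℕ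
  lt i j = 𝟙 (toℕ i <ᵇ toℕ j)
  eq i j = 𝟙 (toℕ i ≡ᵇ toℕ j)
  ne i j = lt i j + lt j i

  <ᵇ-trichotomy : ∀ a b → 𝟙 (a <ᵇ b) + 𝟙 (b <ᵇ a) + 𝟙 (a ≡ᵇ b) ≡ 1
  <ᵇ-trichotomy zero    zero    = refl
  <ᵇ-trichotomy zero    (suc b) = refl
  <ᵇ-trichotomy (suc a) zero    = refl
  <ᵇ-trichotomy (suc a) (suc b) = <ᵇ-trichotomy a b

  ne+eq≡1 : ∀ {n} (i j : Fin n) → ne i j + eq i j ≡ 1
  ne+eq≡1 i j = <ᵇ-trichotomy (toℕ i) (toℕ j)

  ne≤1 : ∀ {n} (i j : Fin n) → ne i j ≤ 1
  ne≤1 i j = subst (ne i j ≤_) (ne+eq≡1 i j) (m≤m+n (ne i j) (eq i j))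

  ne-sym : ∀ {n} (i j : Fin n) → ne i j ≡ ne j i
  ne-sym i j = +-comm (lt i j) (lt j i)

  <ᵇ-trans : ∀ a b c → T (a <ᵇ b) → T (b <ᵇ c) → T (a <ᵇ c)
  <ᵇ-trans a b c a<b b<c = <⇒<ᵇ (<-trans (<ᵇ⇒< a b a<b) (<ᵇ⇒< b c b<c))

  lt-trans : ∀ {n} (i j k : Fin n) → lt i j * lt j k * lt i k ≡ lt i j * lt j k
  lt-trans i j k with toℕ i <ᵇ toℕ j in i<j | toℕ j <ᵇ toℕ k in j<k | toℕ i <ᵇ toℕ k in i<k
  ... | false | _     | _     = refl
  ... | true  | false | _     = refl
  ... | true  | true  | true  = refl
  ... | true  | true  | false =
    ⊥-elim (subst T i<k (<ᵇ-trans (toℕ i) (toℕ j) (toℕ k) (subst T (sym i<j) tt) (subst T (sym j<k) tt)))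

  -- Once u < y, v < x and u < v, a y outside {v, x} lies in exactly one of the slots
  -- u < y < v < x, u < v < y < x, u < v < x < y.
  lt-split : ∀ {n} (u v y x : Fin n) →
             lt u y * lt v x * lt u v * (lt y v + lt v y * ne y x)
             ≡ lt u y * lt y v * lt v x + lt u v * lt v y * lt y x + lt u v * lt v x * lt x y
  lt-split u v y x = begin
    a * b * c * (d + e * (f + g))
      ≡⟨ expand a b c d e f g ⟩
    b * (a * d * c) + b * f * (c * e * a) + b * g * (c * e * a)
      ≡⟨ cong₂ _+_ (cong₂ _+_ (cong (b *_) (lt-trans u y v)) (cong (b * f *_) (lt-trans u v y))) (cong (b * g *_) (lt-trans u v y)) ⟩
    b * (a * d) + b * f * (c * e) + b * g * (c * e)
      ≡⟨ regroup a b c d e f g ⟩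
    a * d * b + c * (e * f * b) + c * (b * g * e)
      ≡⟨ cong₂ _+_ (cong (a * d * b +_) (cong (c *_) (lt-trans v y x))) (cong (c *_) (lt-trans v x y)) ⟩
    a * d * b + c * (e * f) + c * (b * g)
      ≡⟨ reassoc (a * d * b) c e f b g ⟩
    a * d * b + c * e * f + c * b * g
      ∎
    where
    open ≡-Reasoning
    a = lt u y; b = lt v x; c = lt u v; d = lt y v; e = lt v y; f = lt y x; g = lt x y
    expand : ∀ a b c d e f g → a * b * c * (d + e * (f + g)) ≡ b * (a * d * c) + b * f * (c * e * a) + b * g * (c * e * a)
    expand = solve-∀
    regroup : ∀ a b c d e f g → b * (a * d) + b * f * (c * e) + b * g * (c * e) ≡ a * d * b + c * (e * f * b) + c * (b * g * e)
    regroup = solve-∀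
    reassoc : ∀ t c e f b g → t + c * (e * f) + c * (b * g) ≡ t + c * e * f + c * b * g
    reassoc = solve-∀

  ∑-delta : ∀ {n} (i : Fin n) (f : Fin n → ℕ) → ∑[ j < n ] (eq i j * f j) ≡ f i
  ∑-delta {suc n} zero    f = trans (cong (f zero + 0 +_) (sum-replicate-zero n)) (trans (+-identityʳ _) (+-identityʳ _))
  ∑-delta {suc n} (suc i) f = ∑-delta i (f ∘ suc)

  ∑-square-split : ∀ {n} (f : Fin n → ℕ) →
                   sum f * sum f ≡ ∑[ i < n ] ∑[ j < n ] (f i * f j * ne i j) + ∑[ i < n ] (f i * f i)
  ∑-square-split {n} f = begin
    sum f * sum f
      ≡⟨ ∑*∑ f f ⟩
    ∑[ i < n ] ∑[ j < n ] (f i * f j)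
      ≡⟨ sum-cong-≗ (λ i → sum-cong-≗ λ j → split (f i * f j) (ne i j) (eq i j) (ne+eq≡1 i j)) ⟩
    ∑[ i < n ] ∑[ j < n ] (f i * f j * ne i j + eq i j * (f i * f j))
      ≡⟨ ∑²-distrib-+ (λ i j → f i * f j * ne i j) (λ i j → eq i j * (f i * f j)) ⟩
    ∑[ i < n ] ∑[ j < n ] (f i * f j * ne i j) + ∑[ i < n ] ∑[ j < n ] (eq i j * (f i * f j))
      ≡⟨ cong (∑[ i < n ] ∑[ j < n ] (f i * f j * ne i j) +_) (sum-cong-≗ λ i → ∑-delta i (λ j → f i * f j)) ⟩
    ∑[ i < n ] ∑[ j < n ] (f i * f j * ne i j) + ∑[ i < n ] (f i * f i)
      ∎
    where
    open ≡-Reasoning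
    split : ∀ x a b → a + b ≡ 1 → x ≡ x * a + b * x
    split x a b a+b≡1 = trans (sym (*-identityʳ x)) (trans (cong (x *_) (sym a+b≡1))
                          (trans (*-distribˡ-+ x a b) (cong (x * a +_) (*-comm x b))))

  ∑⁴ : ∀ {n} → (Fin n → Fin n → Fin n → Fin n → ℕ) → ℕ
  ∑⁴ {n} f = ∑[ a < n ] ∑[ b < n ] ∑[ c < n ] ∑[ d < n ] f a b c d

  module _ {n : ℕ} where

    ∑⁴-cong : {f g : Fin n → Fin n → Fin n → Fin n → ℕ} → (∀ a b c d → f a b c d ≡ g a b c d) → ∑⁴ f ≡ ∑⁴ g
    ∑⁴-cong f≡g = sum-cong-≗ λ a → sum-cong-≗ λ b → sum-cong-≗ λ c → sum-cong-≗ λ d → f≡g a b c d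

    ∑⁴-mono-≤ : {f g : Fin n → Fin n → Fin n → Fin n → ℕ} → (∀ a b c d → f a b c d ≤ g a b c d) → ∑⁴ f ≤ ∑⁴ g
    ∑⁴-mono-≤ f≤g = ∑-mono-≤ λ a → ∑-mono-≤ λ b → ∑-mono-≤ λ c → ∑-mono-≤ λ d → f≤g a b c d

    ∑⁴-distrib-+ : (f g : Fin n → Fin n → Fin n → Fin n → ℕ) →
                   ∑⁴ (λ a b c d → f a b c d + g a b c d) ≡ ∑⁴ f + ∑⁴ g
    ∑⁴-distrib-+ f g =
      trans (sum-cong-≗ λ a → sum-cong-≗ λ b → ∑²-distrib-+ (f a b) (g a b))
            (∑²-distrib-+ (λ a b → ∑[ c < n ] ∑[ d < n ] f a b c d) (λ a b → ∑[ c < n ] ∑[ d < n ] g a b c d))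

    ∑⁴-distrib-+³ : (f g h : Fin n → Fin n → Fin n → Fin n → ℕ) →
                    ∑⁴ (λ a b c d → f a b c d + g a b c d + h a b c d) ≡ ∑⁴ f + ∑⁴ g + ∑⁴ h
    ∑⁴-distrib-+³ f g h = trans (∑⁴-distrib-+ (λ a b c d → f a b c d + g a b c d) h) (cong (_+ ∑⁴ h) (∑⁴-distrib-+ f g))

    ∑⁴-double : (f g : Fin n → Fin n → Fin n → Fin n → ℕ) → ∑⁴ g ≡ ∑⁴ f →
                ∑⁴ (λ a b c d → f a b c d + g a b c d) ≡ 2 * ∑⁴ f
    ∑⁴-double f g g≡f = trans (∑⁴-distrib-+ f g) (cong (∑⁴ f +_) (trans g≡f (sym (+-identityʳ (∑⁴ f)))))

    ∑⁴-bacd : (f : Fin n → Fin n → Fin n → Fin n → ℕ) → ∑⁴ f ≡ ∑⁴ (λ a b c d → f b a c d)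
    ∑⁴-bacd f = ∑-comm (λ a b → ∑[ c < n ] ∑[ d < n ] f a b c d)

    ∑⁴-acbd : (f : Fin n → Fin n → Fin n → Fin n → ℕ) → ∑⁴ f ≡ ∑⁴ (λ a b c d → f a c b d)
    ∑⁴-acbd f = sum-cong-≗ λ a → ∑-comm (λ b c → ∑[ d < n ] f a b c d)

    ∑⁴-abdc : (f : Fin n → Fin n → Fin n → Fin n → ℕ) → ∑⁴ f ≡ ∑⁴ (λ a b c d → f a b d c)
    ∑⁴-abdc f = sum-cong-≗ λ a → sum-cong-≗ λ b → ∑-comm (f a b)

    ∑⁴-cdab : (f : Fin n → Fin n → Fin n → Fin n → ℕ) → ∑⁴ f ≡ ∑⁴ (λ a b c d → f c d a b)
    ∑⁴-cdab f = trans (∑⁴-acbd f) (trans (∑⁴-bacd _) (trans (∑⁴-abdc _) (∑⁴-acbd _)))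

    ∑⁴-adcb : (f : Fin n → Fin n → Fin n → Fin n → ℕ) → ∑⁴ f ≡ ∑⁴ (λ a b c d → f a d c b)
    ∑⁴-adcb f = trans (∑⁴-acbd f) (trans (∑⁴-abdc _) (∑⁴-acbd _))

    ∑⁴-badc : (f : Fin n → Fin n → Fin n → Fin n → ℕ) → ∑⁴ f ≡ ∑⁴ (λ a b c d → f b a d c)
    ∑⁴-badc f = trans (∑⁴-bacd f) (∑⁴-abdc _)

    ∑⁴-bcda : (f : Fin n → Fin n → Fin n → Fin n → ℕ) → ∑⁴ f ≡ ∑⁴ (λ a b c d → f b c d a)
    ∑⁴-bcda f = trans (∑⁴-abdc f) (trans (∑⁴-acbd _) (∑⁴-bacd _))

module C4Counting {p : ℕ} (G : Graph p) where

  open FiniteSums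
  open import Data.Bool using (true; false; _∧_; not; T; if_then_else_)
  open import Data.Fin.Properties using (toℕ-injective)
  import Data.List as List using (List; map; allFin)
  open import Data.List.Membership.Propositional using (_∈_)
  open import Data.List.Membership.Propositional.Properties using (∈-allFin; ∈-map⁺; ∈-concat⁺′)
  open import Data.Nat using (_+_; _*_; _≤_; _≡ᵇ_; z≤n)
  open import Data.Nat.Properties
  open import Data.Nat.Tactic.RingSolver using (solve-∀)
  open import Algebra.Properties.Semiring.Sum +-*-semiring
    using (sum-syntax; sum-cong-≗; ∑-comm; *-distribˡ-sum; *-distribʳ-sum)
  open import Data.Unit using (tt)
  open import Data.Product using (_×_; _,_; proj₁; proj₂)
  open import Relation.Nullary using (contradiction)

  A Ā : Fin p → Fin p → ℕ
  A u v = 𝟙 (adj G u v)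
  Ā u v = 𝟙 (not (adj G u v))

  A-sym : ∀ u v → A u v ≡ A v u
  A-sym u v = cong 𝟙 (adj-sym G u v)

  Ā-sym : ∀ u v → Ā u v ≡ Ā v u
  Ā-sym u v = cong (𝟙 ∘′ not) (adj-sym G u v)

  A*ne≡A : ∀ u v → A u v * ne u v ≡ A u v
  A*ne≡A u v with adj G u v in u~v | toℕ u ≡ᵇ toℕ v in u≡v
  ... | false | _     = refl
  ... | true  | false = subst (λ b → ne u v + 𝟙 b ≡ 1) u≡v (ne+eq≡1 u v)
  ... | true  | true  with toℕ-injective (≡ᵇ⇒≡ (toℕ u) (toℕ v) (subst T (sym u≡v) tt))
  ... | refl = contradiction (trans (sym u~v) (irrefl G u)) λ ()

  codeg : Fin p → Fin p → ℕ
  codeg u v = ∑[ w < p ] (A u w * A w v)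

  degree≡∑A : ∀ v → degree G v ≡ ∑[ w < p ] A v w
  degree≡∑A v = sum-map-allFin (A v)

  codeg-diag : ∀ u → codeg u u ≡ degree G u
  codeg-diag u = trans (sum-cong-≗ λ w → trans (cong (A u w *_) (A-sym w u)) (𝟙-idem (adj G u w)))
                       (sym (degree≡∑A u))

  common≡codeg : ∀ u v → common G u v ≡ codeg u v
  common≡codeg u v = sum-map-allFin-≗ λ w → 𝟙-∧ (adj G u w) (adj G w v)

  common≤bs : ∀ u v → adj G u v ≡ true → common G u v ≤ bs G
  common≤bs u v u~v = ∈⇒≤foldr-⊔ (∈-concat⁺′ common∈row (∈-map⁺ row (∈-allFin u)))
    where
    row : Fin p → List.List ℕ
    row u = List.map (λ v → if adj G u v then common G u v else 0) (List.allFin p)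
    common∈row : common G u v ∈ row u
    common∈row = subst (λ b → (if b then common G u v else 0) ∈ row u) u~v
                       (∈-map⁺ (λ v → if adj G u v then common G u v else 0) (∈-allFin v))

  A*codeg≤A*bs : ∀ {m} → bs G ≤ m → ∀ u v → A u v * codeg u v ≤ A u v * m
  A*codeg≤A*bs bs≤m u v with adj G u v in u~v
  ... | false = z≤n
  ... | true  = +-monoˡ-≤ 0 (subst (_≤ _) (common≡codeg u v) (≤-trans (common≤bs u v u~v) bs≤m))

  ∑∑A≡2e : ∑[ u < p ] ∑[ v < p ] A u v ≡ 2 * edges G
  ∑∑A≡2e = begin
    ∑[ u < p ] ∑[ v < p ] A u v
      ≡⟨ sum-cong-≗ (λ u → sum-cong-≗ λ v → trans (sym (A*ne≡A u v)) (*-distribˡ-+ (A u v) (lt u v) (lt v u))) ⟩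
    ∑[ u < p ] ∑[ v < p ] (A u v * lt u v + A u v * lt v u)
      ≡⟨ ∑²-distrib-+ (λ u v → A u v * lt u v) (λ u v → A u v * lt v u) ⟩
    E + ∑[ u < p ] ∑[ v < p ] (A u v * lt v u)
      ≡⟨ cong (E +_) (trans (∑-comm (λ u v → A u v * lt v u)) (sum-cong-≗ λ v → sum-cong-≗ λ u → cong (_* lt v u) (A-sym u v))) ⟩
    E + E
      ≡⟨ cong (E +_) (sym (+-identityʳ E)) ⟩
    2 * E
      ≡⟨ cong (2 *_) E≡edges ⟩
    2 * edges G ∎
    where
    open ≡-Reasoning
    E = ∑[ u < p ] ∑[ v < p ] (A u v * lt u v)
    E≡edges : E ≡ edges G
    E≡edges = sym (sum-map-allFin-≗ λ u → sum-map-allFin-≗ λ v → trans (𝟙-∧ (u <F v) (adj G u v)) (*-comm (lt u v) (A u v)))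

  ∑degree≡2e : ∑[ v < p ] degree G v ≡ 2 * edges G
  ∑degree≡2e = trans (sum-cong-≗ degree≡∑A) ∑∑A≡2e

  ∑∑codeg≡∑degree² : ∑[ u < p ] ∑[ y < p ] codeg u y ≡ ∑[ w < p ] (degree G w * degree G w)
  ∑∑codeg≡∑degree² = begin
    ∑[ u < p ] ∑[ y < p ] ∑[ w < p ] (A u w * A w y)   ≡⟨ sum-cong-≗ (λ u → ∑-comm (λ y w → A u w * A w y)) ⟩
    ∑[ u < p ] ∑[ w < p ] ∑[ y < p ] (A u w * A w y)   ≡⟨ ∑-comm (λ u w → ∑[ y < p ] (A u w * A w y)) ⟩
    ∑[ w < p ] ∑[ u < p ] ∑[ y < p ] (A u w * A w y)   ≡⟨ sum-cong-≗ (λ w → sym (∑*∑ (λ u → A u w) (A w))) ⟩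
    ∑[ w < p ] (∑[ u < p ] A u w * ∑[ y < p ] A w y)   ≡⟨ sum-cong-≗ (λ w → cong₂ _*_ (in-degree w) (sym (degree≡∑A w))) ⟩
    ∑[ w < p ] (degree G w * degree G w)               ∎
    where
    open ≡-Reasoning
    in-degree : ∀ w → ∑[ u < p ] A u w ≡ degree G w
    in-degree w = trans (sum-cong-≗ λ u → A-sym u w) (sym (degree≡∑A w))

  S Q : ℕ
  S = ∑[ u < p ] ∑[ y < p ] (ne u y * codeg u y)
  Q = ∑[ u < p ] ∑[ y < p ] (ne u y * (codeg u y * codeg u y))

  S+2e≡∑degree² : S + 2 * edges G ≡ ∑[ w < p ] (degree G w * degree G w)
  S+2e≡∑degree² = begin
    S + 2 * edges G
      ≡⟨ cong (S +_) (sym (trans (sum-cong-≗ λ u → trans (∑-delta u (codeg u)) (codeg-diag u)) ∑degree≡2e)) ⟩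
    S + ∑[ u < p ] ∑[ y < p ] (eq u y * codeg u y)
      ≡⟨ sym (∑²-distrib-+ (λ u y → ne u y * codeg u y) (λ u y → eq u y * codeg u y)) ⟩
    ∑[ u < p ] ∑[ y < p ] (ne u y * codeg u y + eq u y * codeg u y)
      ≡⟨ sum-cong-≗ (λ u → sum-cong-≗ λ y → trans (sym (*-distribʳ-+ (codeg u y) (ne u y) (eq u y)))
                                                 (trans (cong (_* codeg u y) (ne+eq≡1 u y)) (*-identityˡ (codeg u y)))) ⟩
    ∑[ u < p ] ∑[ y < p ] codeg u y
      ≡⟨ ∑∑codeg≡∑degree² ⟩
    ∑[ w < p ] (degree G w * degree G w) ∎
    where open ≡-Reasoning

  S²≤p²Q : S * S ≤ p * p * Q
  S²≤p²Q = begin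
    S * S                                                         ≤⟨ cauchy-schwarz F ⟩
    p * ∑[ u < p ] (F u * F u)                                    ≤⟨ *-monoʳ-≤ p (∑-mono-≤ λ u → cauchy-schwarz (f u)) ⟩
    p * ∑[ u < p ] (p * ∑[ y < p ] (f u y * f u y))              ≡⟨ cong (p *_) (sym (*-distribˡ-sum p (λ u → ∑[ y < p ] (f u y * f u y)))) ⟩
    p * (p * ∑[ u < p ] ∑[ y < p ] (f u y * f u y))              ≡⟨ sym (*-assoc p p _) ⟩
    p * p * ∑[ u < p ] ∑[ y < p ] (f u y * f u y)                ≡⟨ cong (p * p *_) (sum-cong-≗ λ u → sum-cong-≗ λ y → f² u y) ⟩
    p * p * Q                                                     ∎
    where
    open ≤-Reasoning
    f : Fin p → Fin p → ℕ
    f u y = ne u y * codeg u y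
    F : Fin p → ℕ
    F u = ∑[ y < p ] f u y
    f² : ∀ u y → f u y * f u y ≡ ne u y * (codeg u y * codeg u y)
    f² u y = trans (swap (ne u y) (codeg u y)) (cong (_* (codeg u y * codeg u y)) (n≤1⇒n*n≡n (ne≤1 u y)))
      where
      swap : ∀ n c → (n * c) * (n * c) ≡ n * n * (c * c)
      swap = solve-∀

  walk : Fin p → Fin p → Fin p → Fin p → ℕ
  walk u v y x = A u v * A v y * A y x * A x u

  W : ℕ
  W = ∑⁴ (λ u v y x → walk u v y x * ne u y * ne v x)

  distinct-pairs+codeg≡codeg² : ∀ u y →
    ∑[ v < p ] ∑[ x < p ] (A u v * A v y * (A u x * A x y) * ne v x) + codeg u y ≡ codeg u y * codeg u y
  distinct-pairs+codeg≡codeg² u y = sym (trans (∑-square-split g) (cong (∑[ v < p ] ∑[ x < p ] (g v * g x * ne v x) +_) (sum-cong-≗ g-idem)))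
    where
    g : Fin p → ℕ
    g w = A u w * A w y
    g-idem : ∀ w → g w * g w ≡ g w
    g-idem w = trans (cong (λ n → n * n) (sym (𝟙-∧ (adj G u w) (adj G w y)))) (trans (𝟙-idem _) (𝟙-∧ (adj G u w) (adj G w y)))

  W+S≡Q : W + S ≡ Q
  W+S≡Q = begin
    W + S
      ≡⟨ cong (_+ S) (trans (∑⁴-acbd (λ u v y x → walk u v y x * ne u y * ne v x)) (sum-cong-≗ λ u → sum-cong-≗ λ y →
           trans (sum-cong-≗ λ v → trans (sum-cong-≗ λ x → walk≡ u v y x) (sym (*-distribˡ-sum (ne u y) (term u y v))))
                 (sym (*-distribˡ-sum (ne u y) (λ v → ∑[ x < p ] term u y v x))))) ⟩
    ∑[ u < p ] ∑[ y < p ] (ne u y * pairs u y) + S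
      ≡⟨ sym (∑²-distrib-+ (λ u y → ne u y * pairs u y) (λ u y → ne u y * codeg u y)) ⟩
    ∑[ u < p ] ∑[ y < p ] (ne u y * pairs u y + ne u y * codeg u y)
      ≡⟨ sum-cong-≗ (λ u → sum-cong-≗ λ y → trans (sym (*-distribˡ-+ (ne u y) _ _)) (cong (ne u y *_) (distinct-pairs+codeg≡codeg² u y))) ⟩
    Q ∎
    where
    open ≡-Reasoning
    term : Fin p → Fin p → Fin p → Fin p → ℕ
    term u y v x = A u v * A v y * (A u x * A x y) * ne v x
    pairs : Fin p → Fin p → ℕ
    pairs u y = ∑[ v < p ] ∑[ x < p ] term u y v x
    walk≡ : ∀ u v y x → walk u v y x * ne u y * ne v x ≡ ne u y * (A u v * A v y * (A u x * A x y) * ne v x)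
    walk≡ u v y x = trans (cong₂ (λ a b → A u v * A v y * a * b * ne u y * ne v x) (A-sym y x) (A-sym x u))
                          (rearrange (A u v) (A v y) (A x y) (A u x) (ne u y) (ne v x))
      where
      rearrange : ∀ a b c d m n → a * b * c * d * m * n ≡ m * (a * b * (d * c) * n)
      rearrange = solve-∀

  K : Fin p → Fin p → Fin p → Fin p → ℕ
  K u v y x = 𝟙 (cyc G u v y x)

  K≡walk*Ā*Ā : ∀ u v y x → K u v y x ≡ walk u v y x * (Ā u y * Ā v x)
  K≡walk*Ā*Ā u v y x =
    trans (𝟙-∧ (adj G u v) _) (trans (cong (A u v *_) (trans (𝟙-∧ (adj G v y) _) (cong (A v y *_)
      (trans (𝟙-∧ (adj G y x) _) (cong (A y x *_) (trans (𝟙-∧ (adj G x u) _) (cong (A x u *_)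
        (𝟙-∧ (not (adj G u y)) (not (adj G v x)))))))))) (reassoc (A u v) (A v y) (A y x) (A x u) (Ā u y * Ā v x)))
    where
    reassoc : ∀ a b c d e → a * (b * (c * (d * e))) ≡ a * b * c * d * e
    reassoc = solve-∀

  K-cong : ∀ {u v y x u′ v′ y′ x′} → walk u′ v′ y′ x′ ≡ walk u v y x → Ā u′ y′ * Ā v′ x′ ≡ Ā u y * Ā v x →
           K u′ v′ y′ x′ ≡ K u v y x
  K-cong {u} {v} {y} {x} {u′} {v′} {y′} {x′} walk≡ Ā≡ =
    trans (K≡walk*Ā*Ā u′ v′ y′ x′) (trans (cong₂ _*_ walk≡ Ā≡) (sym (K≡walk*Ā*Ā u v y x)))

  K-cdab : ∀ u v y x → K y x u v ≡ K u v y x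
  K-cdab u v y x = K-cong (rotate (A u v) (A v y) (A y x) (A x u)) (cong₂ _*_ (Ā-sym y u) (Ā-sym x v))
    where
    rotate : ∀ a b c d → c * d * a * b ≡ a * b * c * d
    rotate = solve-∀

  K-adcb : ∀ u v y x → K u x y v ≡ K u v y x
  K-adcb u v y x = K-cong walk-reverse (cong (Ā u y *_) (Ā-sym x v))
    where
    reverse : ∀ a b c d → d * c * b * a ≡ a * b * c * d
    reverse = solve-∀
    walk-reverse : walk u x y v ≡ walk u v y x
    walk-reverse = trans (cong₂ _*_ (cong₂ _*_ (cong₂ _*_ (A-sym u x) (A-sym x y)) (A-sym y v)) (A-sym v u))
                         (reverse (A u v) (A v y) (A y x) (A x u))

  K-badc : ∀ u v y x → K v u x y ≡ K u v y x
  K-badc u v y x = K-cong walk-flip (*-comm (Ā v x) (Ā u y))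
    where
    flip : ∀ a b c d → a * d * c * b ≡ a * b * c * d
    flip = solve-∀
    walk-flip : walk v u x y ≡ walk u v y x
    walk-flip = trans (cong₂ _*_ (cong₂ _*_ (cong₂ _*_ (A-sym v u) (A-sym u x)) (A-sym x y)) (A-sym y v))
                      (flip (A u v) (A v y) (A y x) (A x u))

  adj⇒ne≡1 : ∀ {u v} → adj G u v ≡ true → ne u v ≡ 1
  adj⇒ne≡1 {u} {v} u~v = trans (sym (*-identityˡ (ne u v))) (subst (λ b → 𝟙 b * ne u v ≡ 𝟙 b) u~v (A*ne≡A u v))

  cyc⇒ : ∀ {u v y x} → cyc G u v y x ≡ true →
         adj G u v ≡ true × adj G v y ≡ true × adj G y x ≡ true × adj G x u ≡ true × adj G u y ≡ false × adj G v x ≡ false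
  cyc⇒ {u} {v} {y} {x} c with adj G u v | adj G v y | adj G y x | adj G x u | adj G u y | adj G v x
  ... | true  | true  | true  | true  | false | false = refl , refl , refl , refl , refl , refl
  ... | false | _     | _     | _     | _     | _     = contradiction c λ ()
  ... | true  | false | _     | _     | _     | _     = contradiction c λ ()
  ... | true  | true  | false | _     | _     | _     = contradiction c λ ()
  ... | true  | true  | true  | false | _     | _     = contradiction c λ ()
  ... | true  | true  | true  | true  | true  | _     = contradiction c λ ()
  ... | true  | true  | true  | true  | false | true  = contradiction c λ ()

  K*ne≡K : ∀ u v y x → K u v y x * ne u v ≡ K u v y x
  K*ne≡K u v y x with cyc G u v y x in c
  ... | false = refl
  ... | true  = trans (*-identityˡ (ne u v)) (adj⇒ne≡1 (proj₁ (cyc⇒ c)))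

  K*y-cases≡K : ∀ u v y x → K u v y x * (lt y v + lt v y * ne y x) ≡ K u v y x
  K*y-cases≡K u v y x with cyc G u v y x in c
  ... | false = refl
  ... | true  with cyc⇒ c
  ...   | _ , v~y , y~x , _ = trans (*-identityˡ _) (trans (cong (λ n → lt y v + lt v y * n) (adj⇒ne≡1 y~x))
                            (trans (cong (lt y v +_) (*-identityʳ (lt v y))) (trans (ne-sym y v) (adj⇒ne≡1 v~y))))

  K*K≡0 : ∀ {u v y x u′ v′ y′ x′} → (cyc G u v y x ≡ true → cyc G u′ v′ y′ x′ ≡ true → true ≡ false) →
          K u v y x * K u′ v′ y′ x′ ≡ 0
  K*K≡0 {u} {v} {y} {x} {u′} {v′} {y′} {x′} exclusive with cyc G u v y x | cyc G u′ v′ y′ x′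
  ... | false | _     = refl
  ... | true  | false = refl
  ... | true  | true  = contradiction (exclusive refl refl) λ ()

  𝟙-inducesC4 : ∀ a b c d → 𝟙 (inducesC4 G a b c d) ≡ K a b c d + K a b d c + K a c b d
  𝟙-inducesC4 a b c d = 𝟙-∨³ (cyc G a b c d) (cyc G a b d c) (cyc G a c b d)
    (K*K≡0 λ abcd abdc → trans (sym (proj₁ (proj₂ (cyc⇒ abdc)))) (proj₂ (proj₂ (proj₂ (proj₂ (proj₂ (cyc⇒ abcd)))))))
    (K*K≡0 λ abcd acbd → trans (sym (proj₁ (cyc⇒ abcd))) (proj₁ (proj₂ (proj₂ (proj₂ (proj₂ (cyc⇒ acbd)))))))
    (K*K≡0 λ abdc acbd → trans (sym (proj₁ (cyc⇒ abdc))) (proj₁ (proj₂ (proj₂ (proj₂ (proj₂ (cyc⇒ acbd)))))))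

  chain : Fin p → Fin p → Fin p → Fin p → ℕ
  chain a b c d = lt a b * lt b c * lt c d

  M-C4≡∑⁴ : M-C4 G ≡ ∑⁴ (λ a b c d → K a b c d * chain a b c d + K a b d c * chain a b c d + K a c b d * chain a b c d)
  M-C4≡∑⁴ =
    sum-map-allFin-≗ λ a → sum-map-allFin-≗ λ b → sum-map-allFin-≗ λ c → sum-map-allFin-≗ λ d → term a b c d
    where
    distrib : ∀ l₁ l₂ l₃ k₁ k₂ k₃ → l₁ * (l₂ * (l₃ * (k₁ + k₂ + k₃))) ≡ k₁ * (l₁ * l₂ * l₃) + k₂ * (l₁ * l₂ * l₃) + k₃ * (l₁ * l₂ * l₃)
    distrib = solve-∀
    term : ∀ a b c d → 𝟙 ((a <F b) ∧ (b <F c) ∧ (c <F d) ∧ inducesC4 G a b c d)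
                      ≡ K a b c d * chain a b c d + K a b d c * chain a b c d + K a c b d * chain a b c d
    term a b c d = begin
      𝟙 ((a <F b) ∧ (b <F c) ∧ (c <F d) ∧ inducesC4 G a b c d)
        ≡⟨ trans (𝟙-∧ (a <F b) _) (cong (lt a b *_) (trans (𝟙-∧ (b <F c) _) (cong (lt b c *_) (𝟙-∧ (c <F d) _)))) ⟩
      lt a b * (lt b c * (lt c d * 𝟙 (inducesC4 G a b c d)))
        ≡⟨ cong (λ k → lt a b * (lt b c * (lt c d * k))) (𝟙-inducesC4 a b c d) ⟩
      lt a b * (lt b c * (lt c d * (K a b c d + K a b d c + K a c b d)))
        ≡⟨ distrib (lt a b) (lt b c) (lt c d) (K a b c d) (K a b d c) (K a c b d) ⟩
      K a b c d * chain a b c d + K a b d c * chain a b c d + K a c b d * chain a b c d ∎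
      where open ≡-Reasoning

  -- Each halving keeps one representative under a symmetry of the 4-cycle (u < y, then v < x,
  -- then u < v); what is left is the position of y, whose three possibilities are the three
  -- cyclic orders in inducesC4.
  ∑⁴K-halve-uy : ∑⁴ (λ u v y x → K u v y x * ne u y * ne v x) ≡ 2 * ∑⁴ (λ u v y x → K u v y x * lt u y * ne v x)
  ∑⁴K-halve-uy = trans (∑⁴-cong λ u v y x → distrib (K u v y x) (lt u y) (lt y u) (ne v x))
    (∑⁴-double _ g (trans (∑⁴-cdab g) (∑⁴-cong λ u v y x → cong₂ (λ k n → k * lt u y * n) (K-cdab u v y x) (ne-sym x v))))
    where
    g : Fin p → Fin p → Fin p → Fin p → ℕ
    g u v y x = K u v y x * lt y u * ne v x
    distrib : ∀ k a b n → k * (a + b) * n ≡ k * a * n + k * b * n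
    distrib = solve-∀

  ∑⁴K-halve-vx : ∑⁴ (λ u v y x → K u v y x * lt u y * ne v x) ≡ 2 * ∑⁴ (λ u v y x → K u v y x * lt u y * lt v x)
  ∑⁴K-halve-vx = trans (∑⁴-cong λ u v y x → *-distribˡ-+ (K u v y x * lt u y) (lt v x) (lt x v))
    (∑⁴-double _ g (trans (∑⁴-adcb g) (∑⁴-cong λ u v y x → cong (λ k → k * lt u y * lt v x) (K-adcb u v y x))))
    where
    g : Fin p → Fin p → Fin p → Fin p → ℕ
    g u v y x = K u v y x * lt u y * lt x v

  ∑⁴K-halve-uv : ∑⁴ (λ u v y x → K u v y x * lt u y * lt v x) ≡ 2 * ∑⁴ (λ u v y x → K u v y x * lt u y * lt v x * lt u v)
  ∑⁴K-halve-uv = trans (∑⁴-cong λ u v y x → trans (cong (λ k → k * lt u y * lt v x) (sym (K*ne≡K u v y x)))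
                                                  (distrib (K u v y x) (lt u v) (lt v u) (lt u y) (lt v x)))
    (∑⁴-double _ g (trans (∑⁴-badc g) (∑⁴-cong λ u v y x → trans (cong (λ k → k * lt v x * lt u y * lt u v) (K-badc u v y x))
                                                                   (swap (K u v y x) (lt v x) (lt u y) (lt u v)))))
    where
    g : Fin p → Fin p → Fin p → Fin p → ℕ
    g u v y x = K u v y x * lt u y * lt v x * lt v u
    distrib : ∀ k a b c d → k * (a + b) * c * d ≡ k * c * d * a + k * c * d * b
    distrib = solve-∀
    swap : ∀ k a b c → k * a * b * c ≡ k * b * a * c
    swap = solve-∀

  ∑⁴K-canonical≡M : ∑⁴ (λ u v y x → K u v y x * lt u y * lt v x * lt u v) ≡ M-C4 G
  ∑⁴K-canonical≡M = begin
    ∑⁴ (λ u v y x → K u v y x * lt u y * lt v x * lt u v)    ≡⟨ ∑⁴-cong y-position ⟩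
    ∑⁴ (λ u v y x → t₁ u v y x + t₂ u v y x + t₃ u v y x)   ≡⟨ ∑⁴-distrib-+³ t₁ t₂ t₃ ⟩
    ∑⁴ t₁ + ∑⁴ t₂ + ∑⁴ t₃                                   ≡⟨ cong₂ _+_ (cong (_+ ∑⁴ t₂) (∑⁴-acbd t₁)) (∑⁴-abdc t₃) ⟩
    ∑⁴ m₃ + ∑⁴ m₁ + ∑⁴ m₂                                   ≡⟨ rotate (∑⁴ m₃) (∑⁴ m₁) (∑⁴ m₂) ⟩
    ∑⁴ m₁ + ∑⁴ m₂ + ∑⁴ m₃                                   ≡⟨ sym (∑⁴-distrib-+³ m₁ m₂ m₃) ⟩
    ∑⁴ (λ a b c d → m₁ a b c d + m₂ a b c d + m₃ a b c d)   ≡⟨ sym M-C4≡∑⁴ ⟩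
    M-C4 G                                                  ∎
    where
    open ≡-Reasoning
    t₁ t₂ t₃ m₁ m₂ m₃ : Fin p → Fin p → Fin p → Fin p → ℕ
    t₁ u v y x = K u v y x * chain u y v x
    t₂ u v y x = K u v y x * chain u v y x
    t₃ u v y x = K u v y x * chain u v x y
    m₁ a b c d = K a b c d * chain a b c d
    m₂ a b c d = K a b d c * chain a b c d
    m₃ a b c d = K a c b d * chain a b c d
    rotate : ∀ a b c → a + b + c ≡ b + c + a
    rotate = solve-∀
    y-position : ∀ u v y x → K u v y x * lt u y * lt v x * lt u v ≡ t₁ u v y x + t₂ u v y x + t₃ u v y x
    y-position u v y x = begin
      K u v y x * lt u y * lt v x * lt u v
        ≡⟨ cong (λ k → k * lt u y * lt v x * lt u v) (sym (K*y-cases≡K u v y x)) ⟩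
      K u v y x * (lt y v + lt v y * ne y x) * lt u y * lt v x * lt u v
        ≡⟨ regroup (K u v y x) (lt y v + lt v y * ne y x) (lt u y) (lt v x) (lt u v) ⟩
      K u v y x * (lt u y * lt v x * lt u v * (lt y v + lt v y * ne y x))
        ≡⟨ cong (K u v y x *_) (lt-split u v y x) ⟩
      K u v y x * (chain u y v x + chain u v y x + chain u v x y)
        ≡⟨ distrib (K u v y x) (chain u y v x) (chain u v y x) (chain u v x y) ⟩
      K u v y x * chain u y v x + K u v y x * chain u v y x + K u v y x * chain u v x y ∎
      where
      regroup : ∀ k s a b c → k * s * a * b * c ≡ k * (a * b * c * s)
      regroup = solve-∀
      distrib : ∀ k a b c → k * (a + b + c) ≡ k * a + k * b + k * c
      distrib = solve-∀

  ∑⁴K≡8M : ∑⁴ (λ u v y x → K u v y x * ne u y * ne v x) ≡ 8 * M-C4 G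
  ∑⁴K≡8M = begin
    ∑⁴ (λ u v y x → K u v y x * ne u y * ne v x)                  ≡⟨ ∑⁴K-halve-uy ⟩
    2 * ∑⁴ (λ u v y x → K u v y x * lt u y * ne v x)              ≡⟨ cong (2 *_) ∑⁴K-halve-vx ⟩
    2 * (2 * ∑⁴ (λ u v y x → K u v y x * lt u y * lt v x))        ≡⟨ cong (λ n → 2 * (2 * n)) ∑⁴K-halve-uv ⟩
    2 * (2 * (2 * ∑⁴ (λ u v y x → K u v y x * lt u y * lt v x * lt u v))) ≡⟨ cong (λ n → 2 * (2 * (2 * n))) ∑⁴K-canonical≡M ⟩
    2 * (2 * (2 * M-C4 G))                                        ≡⟨ eight (M-C4 G) ⟩
    8 * M-C4 G                                                    ∎
    where
    open ≡-Reasoning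
    eight : ∀ n → 2 * (2 * (2 * n)) ≡ 8 * n
    eight = solve-∀

  R : ℕ
  R = ∑⁴ (λ u v y x → walk u v y x * A u y)

  W≤8M+2R : W ≤ 8 * M-C4 G + R + R
  W≤8M+2R = begin
    W ≤⟨ ∑⁴-mono-≤ (λ u v y x → ≤-split-chords (walk u v y x) (adj G u y) (adj G v x) (ne≤1 u y) (ne≤1 v x)) ⟩
    ∑⁴ (λ u v y x → walk u v y x * (Ā u y * Ā v x) * ne u y * ne v x + walk u v y x * A u y + walk u v y x * A v x)
      ≡⟨ trans (∑⁴-distrib-+ (λ u v y x → walk u v y x * (Ā u y * Ā v x) * ne u y * ne v x + walk u v y x * A u y) chord₂)
               (cong (_+ ∑⁴ chord₂) (∑⁴-distrib-+ induced (λ u v y x → walk u v y x * A u y))) ⟩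
    ∑⁴ induced + R + ∑⁴ chord₂
      ≡⟨ cong₂ (λ a b → a + R + b) (trans (∑⁴-cong λ u v y x → cong (λ k → k * ne u y * ne v x) (sym (K≡walk*Ā*Ā u v y x))) ∑⁴K≡8M)
                                   (trans (∑⁴-bcda chord₂) (∑⁴-cong λ u v y x → cong₂ _*_ (rotate (A u v) (A v y) (A y x) (A x u)) (A-sym y u))) ⟩
    8 * M-C4 G + R + R ∎
    where
    open ≤-Reasoning
    induced chord₂ : Fin p → Fin p → Fin p → Fin p → ℕ
    induced u v y x = walk u v y x * (Ā u y * Ā v x) * ne u y * ne v x
    chord₂ u v y x = walk u v y x * A v x
    rotate : ∀ a b c d → b * c * d * a ≡ a * b * c * d
    rotate = solve-∀

  ∑²-chorded-walks : ∀ u y → ∑[ v < p ] ∑[ x < p ] (walk u v y x * A u y) ≡ A u y * codeg u y * (A y u * codeg y u)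
  ∑²-chorded-walks u y = begin
    ∑[ v < p ] ∑[ x < p ] (walk u v y x * A u y)
      ≡⟨ sum-cong-≗ (λ v → sum-cong-≗ λ x → regroup (A u v) (A v y) (A y x) (A x u) (A u y)) ⟩
    ∑[ v < p ] ∑[ x < p ] (A u y * ((A u v * A v y) * (A y x * A x u)))
      ≡⟨ ∑²-scaled-product (A u y) (λ v → A u v * A v y) (λ x → A y x * A x u) ⟩
    A u y * (codeg u y * codeg y u)
      ≡⟨ cong (_* (codeg u y * codeg y u)) (sym (𝟙-idem (adj G u y))) ⟩
    A u y * A u y * (codeg u y * codeg y u)
      ≡⟨ shuffle (A u y) (A u y) (codeg u y) (codeg y u) ⟩
    A u y * codeg u y * (A u y * codeg y u)
      ≡⟨ cong (λ a → A u y * codeg u y * (a * codeg y u)) (A-sym u y) ⟩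
    A u y * codeg u y * (A y u * codeg y u) ∎
    where
    open ≡-Reasoning
    regroup : ∀ a b c d e → a * b * c * d * e ≡ e * ((a * b) * (c * d))
    regroup = solve-∀
    shuffle : ∀ a a′ c c′ → a * a′ * (c * c′) ≡ a * c * (a′ * c′)
    shuffle = solve-∀

  R≤2e·m² : ∀ {m} → bs G ≤ m → R ≤ 2 * edges G * (m * m)
  R≤2e·m² {m} bs≤m = begin
    R
      ≡⟨ trans (∑⁴-acbd (λ u v y x → walk u v y x * A u y)) (sum-cong-≗ λ u → sum-cong-≗ λ y → ∑²-chorded-walks u y) ⟩
    ∑[ u < p ] ∑[ y < p ] ((A u y * codeg u y) * (A y u * codeg y u))
      ≤⟨ ∑-mono-≤ (λ u → ∑-mono-≤ λ y → *-mono-≤ (A*codeg≤A*bs bs≤m u y) (A*codeg≤A*bs bs≤m y u)) ⟩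
    ∑[ u < p ] ∑[ y < p ] ((A u y * m) * (A y u * m))
      ≡⟨ sum-cong-≗ (λ u → sum-cong-≗ λ y → trans (cong (λ a → A u y * m * (a * m)) (A-sym y u))
                                                 (trans (regroup (A u y) m) (cong (_* (m * m)) (𝟙-idem (adj G u y))))) ⟩
    ∑[ u < p ] ∑[ y < p ] (A u y * (m * m))
      ≡⟨ trans (sum-cong-≗ λ u → sym (*-distribʳ-sum (m * m) (A u))) (sym (*-distribʳ-sum (m * m) λ u → ∑[ y < p ] A u y)) ⟩
    ∑[ u < p ] ∑[ y < p ] A u y * (m * m)
      ≡⟨ cong (_* (m * m)) ∑∑A≡2e ⟩
    2 * edges G * (m * m) ∎
    where
    open ≤-Reasoning
    regroup : ∀ a m → a * m * (a * m) ≡ a * a * (m * m)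
    regroup = solve-∀

  W≤8M+4e·m² : ∀ {m} → bs G ≤ m → W ≤ 8 * M-C4 G + 4 * (edges G * (m * m))
  W≤8M+4e·m² {m} bs≤m = begin
    W                                                           ≤⟨ W≤8M+2R ⟩
    8 * M-C4 G + R + R                                          ≤⟨ +-mono-≤ (+-monoʳ-≤ (8 * M-C4 G) (R≤2e·m² bs≤m)) (R≤2e·m² bs≤m) ⟩
    8 * M-C4 G + 2 * edges G * (m * m) + 2 * edges G * (m * m)  ≡⟨ four (8 * M-C4 G) (edges G) (m * m) ⟩
    8 * M-C4 G + 4 * (edges G * (m * m))                        ∎
    where
    open ≤-Reasoning
    four : ∀ M e m → M + 2 * e * m + 2 * e * m ≡ M + 4 * (e * m)
    four = solve-∀

  S²≤p²[8M+4em²+S] : ∀ {m} → bs G ≤ m → S * S ≤ p * p * (8 * M-C4 G + 4 * (edges G * (m * m)) + S)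
  S²≤p²[8M+4em²+S] {m} bs≤m = begin
    S * S                                               ≤⟨ S²≤p²Q ⟩
    p * p * Q                                           ≡⟨ cong (p * p *_) (sym W+S≡Q) ⟩
    p * p * (W + S)                                     ≤⟨ *-monoʳ-≤ (p * p) (+-monoˡ-≤ S (W≤8M+4e·m² bs≤m)) ⟩
    p * p * (8 * M-C4 G + 4 * (edges G * (m * m)) + S)  ∎
    where open ≤-Reasoning

module RationalBounds where

  open import Data.Integer using (+_)
  open import Data.Rational using (ℚ; 0ℚ; 1ℚ; _<_; _≤_; _+_; _*_; _-_; -_; _/_; positive; nonNegative)
  open import Data.Rational.Properties
  open import Data.Rational.Solver using (module +-*-Solver)
  open +-*-Solver using (solve; _:+_; _:*_; _:-_; con; _:=_)

  p<q⇒0<q-p : ∀ {p q} → p < q → 0ℚ < q - p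
  p<q⇒0<q-p {p} {q} p<q = subst (_< q - p) (+-inverseʳ p) (+-monoˡ-< (- p) p<q)

  0<q-p⇒p<q : ∀ {p q} → 0ℚ < q - p → p < q
  0<q-p⇒p<q {p} {q} 0<q-p = subst₂ _<_ (+-identityˡ p) (q-p+p≡q p q) (+-monoˡ-< p 0<q-p)
    where
    q-p+p≡q : ∀ p q → q - p + p ≡ q
    q-p+p≡q = solve 2 (λ p q → q :- p :+ p := q) refl

  *-pos : ∀ {x y} → 0ℚ < x → 0ℚ < y → 0ℚ < x * y
  *-pos {x} {y} 0<x 0<y = positive⁻¹ (x * y) {{pos*pos⇒pos x {{positive 0<x}} y {{positive 0<y}}}}

  *-nonNeg : ∀ {x y} → 0ℚ ≤ x → 0ℚ ≤ y → 0ℚ ≤ x * y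
  *-nonNeg {x} {y} 0≤x 0≤y = nonNegative⁻¹ (x * y) {{nonNeg*nonNeg⇒nonNeg x {{nonNegative 0≤x}} y {{nonNegative 0≤y}}}}

  *-mono-≤-nonNeg : ∀ {a b c d} → 0ℚ ≤ a → 0ℚ ≤ c → a ≤ b → c ≤ d → a * c ≤ b * d
  *-mono-≤-nonNeg {a} {b} {c} {d} 0≤a 0≤c a≤b c≤d =
    ≤-trans (*-monoʳ-≤-nonNeg c {{nonNegative 0≤c}} a≤b) (*-monoˡ-≤-nonNeg b {{nonNegative (≤-trans 0≤a a≤b)}} c≤d)

  σ*a≤X : ∀ {P S X σ a} → 0ℚ < P → 0ℚ ≤ σ → 0ℚ ≤ a → σ ≤ S → P * P * (a + 1ℚ) ≤ σ →
          S * S ≤ P * P * (X + S) → σ * a ≤ X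
  σ*a≤X {P} {S} {X} {σ} {a} 0<P 0≤σ 0≤a σ≤S P²[a+1]≤σ S²≤P²[X+S] = *-cancelˡ-≤-pos (P * P) {{positive 0<P²}} (begin
    P * P * (σ * a)              ≡⟨ solve 3 (λ P σ a → P :* P :* (σ :* a) := σ :* (P :* P :* a)) refl P σ a ⟩
    σ * (P * P * a)              ≤⟨ *-mono-≤-nonNeg 0≤σ (*-nonNeg (<⇒≤ 0<P²) 0≤a) σ≤S P²a≤S-P² ⟩
    S * (S - P * P)              ≡⟨ solve 2 (λ S P → S :* (S :- P :* P) := S :* S :- P :* P :* S) refl S P ⟩
    S * S - P * P * S            ≤⟨ +-monoˡ-≤ (- (P * P * S)) S²≤P²[X+S] ⟩
    P * P * (X + S) - P * P * S  ≡⟨ solve 3 (λ S P X → P :* P :* (X :+ S) :- P :* P :* S := P :* P :* X) refl S P X ⟩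
    P * P * X                    ∎)
    where
    open ≤-Reasoning
    0<P² : 0ℚ < P * P
    0<P² = *-pos 0<P 0<P
    P²a≤S-P² : P * P * a ≤ S - P * P
    P²a≤S-P² = subst (_≤ S - P * P) (solve 2 (λ P a → P :* P :* (a :+ con 1ℚ) :- P :* P := P :* P :* a) refl P a)
                     (+-monoˡ-≤ (- (P * P)) (≤-trans P²[a+1]≤σ σ≤S))

  -- With t = LP and gap := PL² − 5(2L + 1), σa − 8L³P²q/5 = 2q(t·gap/5 + L + 1) is positive.
  8λ³p²q/5<σa : ∀ {L P q} → 0ℚ < L → 0ℚ < P → 0ℚ < (+ 2) / 1 * q →
                (+ 5) / 1 * ((+ 2) / 1 * L + 1ℚ) < P * (L * L) →
                (+ 8) / 1 * (L * L * L * P * P * ((+ 1) / 5) * q) < (+ 2) / 1 * q * (L * P - 1ℚ) * (L * (L * P - 1ℚ) - 1ℚ)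
  8λ³p²q/5<σa {L} {P} {q} 0<L 0<P 0<2q gap>0 = 0<q-p⇒p<q (subst (0ℚ <_) surplus
    (*-pos 0<2q (+-mono-≤-< (+-mono-≤ (*-nonNeg (*-nonNeg (<⇒≤ (*-pos 0<L 0<P)) (nonNegative⁻¹ ((+ 1) / 5))) (<⇒≤ (p<q⇒0<q-p gap>0)))
                                      (<⇒≤ 0<L))
                            (positive⁻¹ 1ℚ))))
    where
    two = (+ 2) / 1
    gap = P * (L * L) - (+ 5) / 1 * (two * L + 1ℚ)
    surplus : two * q * (L * P * ((+ 1) / 5) * gap + L + 1ℚ)
              ≡ two * q * (L * P - 1ℚ) * (L * (L * P - 1ℚ) - 1ℚ) - (+ 8) / 1 * (L * L * L * P * P * ((+ 1) / 5) * q)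
    surplus = solve 3 (λ L P q → con two :* q :* (L :* P :* con ((+ 1) / 5) :* (P :* (L :* L) :- con ((+ 5) / 1) :* (con two :* L :+ con 1ℚ))
                                                  :+ L :+ con 1ℚ)
                      := con two :* q :* (L :* P :- con 1ℚ) :* (L :* (L :* P :- con 1ℚ) :- con 1ℚ)
                         :- con ((+ 8) / 1) :* (L :* L :* L :* P :* P :* con ((+ 1) / 5) :* q)) refl L P q

  -- The degree bounds give S ≥ σ := 2q(LP − 1) ≥ P²(a + 1) for a := L(LP − 1) − 1 > 0.
  8λ³p²q/5<X : ∀ {L P q S X} → 0ℚ < L →
               (+ 5) / 1 * ((+ 2) / 1 * L + 1ℚ) < P * (L * L) →
               S * S ≤ P * P * (X + S) →
               L * P * ((+ 2) / 1 * q) ≤ S + (+ 2) / 1 * q →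
               P * (L * P) ≤ (+ 2) / 1 * q →
               (+ 8) / 1 * (L * L * L * P * P * ((+ 1) / 5) * q) < X
  8λ³p²q/5<X {L} {P} {q} {S} {X} 0<L gap>0 S²≤P²[X+S] LP·2q≤S+2q P·LP≤2q =
    <-≤-trans (8λ³p²q/5<σa 0<L 0<P 0<2q gap>0) (σ*a≤X 0<P (<⇒≤ (*-pos 0<2q 0<t-1)) (<⇒≤ 0<a) σ≤S P²[a+1]≤σ S²≤P²[X+S])
    where
    two = (+ 2) / 1
    t = L * P
    σ = two * q * (t - 1ℚ)
    a = L * (t - 1ℚ) - 1ℚ

    L<5[2L+1] : L < (+ 5) / 1 * (two * L + 1ℚ)
    L<5[2L+1] = 0<q-p⇒p<q (subst (0ℚ <_) (solve 1 (λ L → con ((+ 9) / 1) :* L :+ con ((+ 5) / 1)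
                                                      := con ((+ 5) / 1) :* (con two :* L :+ con 1ℚ) :- L) refl L)
                                        (+-mono-≤-< (*-nonNeg (nonNegative⁻¹ ((+ 9) / 1)) (<⇒≤ 0<L)) (positive⁻¹ ((+ 5) / 1))))
    0<P : 0ℚ < P
    0<P = *-cancelʳ-<-nonNeg (L * L) {{nonNegative (<⇒≤ (*-pos 0<L 0<L))}}
            (subst (_< P * (L * L)) (sym (*-zeroˡ (L * L))) (<-trans 0<L (<-trans L<5[2L+1] gap>0)))
    0<t-1 : 0ℚ < t - 1ℚ
    0<t-1 = p<q⇒0<q-p (*-cancelˡ-<-nonNeg L {{nonNegative (<⇒≤ 0<L)}}
              (subst₂ _<_ (sym (*-identityʳ L)) (solve 2 (λ L P → P :* (L :* L) := L :* (L :* P)) refl L P)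
                      (<-trans L<5[2L+1] gap>0)))
    0<2q : 0ℚ < two * q
    0<2q = <-≤-trans (*-pos 0<P (*-pos 0<L 0<P)) P·LP≤2q
    0<a : 0ℚ < a
    0<a = subst (0ℚ <_) (solve 2 (λ L P → (P :* (L :* L) :- con ((+ 5) / 1) :* (con two :* L :+ con 1ℚ))
                                          :+ (con ((+ 9) / 1) :* L :+ con ((+ 4) / 1))
                                        := L :* (L :* P :- con 1ℚ) :- con 1ℚ) refl L P)
                (+-mono-<-≤ (p<q⇒0<q-p gap>0) (+-mono-≤ (*-nonNeg (nonNegative⁻¹ ((+ 9) / 1)) (<⇒≤ 0<L)) (nonNegative⁻¹ ((+ 4) / 1))))
    σ≤S : σ ≤ S
    σ≤S = subst₂ _≤_ (solve 3 (λ L P q → L :* P :* (con two :* q) :- con two :* q := con two :* q :* (L :* P :- con 1ℚ)) refl L P q)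
                     (solve 2 (λ S q → S :+ con two :* q :- con two :* q := S) refl S q)
                     (+-monoˡ-≤ (- (two * q)) LP·2q≤S+2q)
    P²[a+1]≤σ : P * P * (a + 1ℚ) ≤ σ
    P²[a+1]≤σ = subst (_≤ σ) (solve 2 (λ L P → P :* (L :* P) :* (L :* P :- con 1ℚ)
                                             := P :* P :* (L :* (L :* P :- con 1ℚ) :- con 1ℚ :+ con 1ℚ)) refl L P)
                      (*-monoʳ-≤-nonNeg (t - 1ℚ) {{nonNegative (<⇒≤ 0<t-1)}} P·LP≤2q)

  unscale-by-8 : ∀ {c m q M : ℚ} → (+ 8) / 1 * (c * ((+ 1) / 5) * q) < (+ 8) / 1 * M + (+ 4) / 1 * (q * (m * m)) →
                 (c * ((+ 1) / 5) - m * m * ((+ 1) / 2)) * q < M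
  unscale-by-8 {c} {m} {q} {M} 8κ<X =
    *-cancelˡ-<-nonNeg ((+ 8) / 1) (subst₂ _<_ lhs rhs (+-monoˡ-< (- ((+ 4) / 1 * (q * (m * m)))) 8κ<X))
    where
    lhs : (+ 8) / 1 * (c * ((+ 1) / 5) * q) - (+ 4) / 1 * (q * (m * m)) ≡ (+ 8) / 1 * ((c * ((+ 1) / 5) - m * m * ((+ 1) / 2)) * q)
    lhs = solve 3 (λ c m q → con ((+ 8) / 1) :* (c :* con ((+ 1) / 5) :* q) :- con ((+ 4) / 1) :* (q :* (m :* m))
                    := con ((+ 8) / 1) :* ((c :* con ((+ 1) / 5) :- m :* m :* con ((+ 1) / 2)) :* q)) refl c m q
    rhs : (+ 8) / 1 * M + (+ 4) / 1 * (q * (m * m)) - (+ 4) / 1 * (q * (m * m)) ≡ (+ 8) / 1 * M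
    rhs = solve 3 (λ M q m → con ((+ 8) / 1) :* M :+ con ((+ 4) / 1) :* (q :* (m :* m)) :- con ((+ 4) / 1) :* (q :* (m :* m))
                    := con ((+ 8) / 1) :* M) refl M q m

module Embedding where

  open import Data.Integer as ℤ using (+_)
  import Data.Integer.Properties as ℤ
  import Data.Nat as ℕ
  import Data.Nat.Properties as ℕ
  open import Data.Nat.Coprimality using (1-coprimeTo) renaming (sym to coprime-sym)
  open import Data.Rational using (ℚ; mkℚ; 0ℚ; _≤_; _+_; _*_; _/_; *≤*)
  open import Data.Rational.Properties using (normalize-coprime; /-cong; *-zeroʳ; *-distribˡ-+; +-mono-≤; ≤-reflexive; module ≤-Reasoning)
  open import Algebra.Properties.Semiring.Sum ℕ.+-*-semiring using (sum)

  ℕ→ℚ≡mkℚ : ∀ n → ℕ→ℚ n ≡ mkℚ (+ n) 0 (coprime-sym (1-coprimeTo n))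
  ℕ→ℚ≡mkℚ n = normalize-coprime (coprime-sym (1-coprimeTo n))

  ℕ→ℚ-+ : ∀ a b → ℕ→ℚ (a ℕ.+ b) ≡ ℕ→ℚ a + ℕ→ℚ b
  ℕ→ℚ-+ a b = begin
    (+ (a ℕ.+ b)) / 1                  ≡⟨ /-cong (cong₂ ℤ._+_ (ℤ.*-identityʳ (+ a)) (ℤ.*-identityʳ (+ b))) refl ⟨
    (+ a ℤ.* + 1 ℤ.+ + b ℤ.* + 1) / 1  ≡⟨ cong₂ _+_ (ℕ→ℚ≡mkℚ a) (ℕ→ℚ≡mkℚ b) ⟨
    ℕ→ℚ a + ℕ→ℚ b                      ∎
    where open ≡-Reasoning

  ℕ→ℚ-* : ∀ a b → ℕ→ℚ (a ℕ.* b) ≡ ℕ→ℚ a * ℕ→ℚ b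
  ℕ→ℚ-* a b = begin
    (+ (a ℕ.* b)) / 1  ≡⟨ /-cong (ℤ.pos-* a b) refl ⟩
    (+ a ℤ.* + b) / 1  ≡⟨ cong₂ _*_ (ℕ→ℚ≡mkℚ a) (ℕ→ℚ≡mkℚ b) ⟨
    ℕ→ℚ a * ℕ→ℚ b      ∎
    where open ≡-Reasoning

  ℕ→ℚ-mono-≤ : ∀ {a b} → a ℕ.≤ b → ℕ→ℚ a ≤ ℕ→ℚ b
  ℕ→ℚ-mono-≤ {a} {b} a≤b = subst₂ _≤_ (sym (ℕ→ℚ≡mkℚ a)) (sym (ℕ→ℚ≡mkℚ b))
                                    (*≤* (ℤ.*-monoʳ-≤-nonNeg (+ 1) (ℤ.+≤+ a≤b)))

  0≤ℕ→ℚ : ∀ n → 0ℚ ≤ ℕ→ℚ n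
  0≤ℕ→ℚ n = ℕ→ℚ-mono-≤ {0} {n} ℕ.z≤n

  ∑-scale-≤ : ∀ {n} (c : ℚ) (f g : Fin n → ℕ) → (∀ i → c * ℕ→ℚ (f i) ≤ ℕ→ℚ (g i)) →
              c * ℕ→ℚ (sum f) ≤ ℕ→ℚ (sum g)
  ∑-scale-≤ {ℕ.zero}  c f g cf≤g = ≤-reflexive (*-zeroʳ c)
  ∑-scale-≤ {ℕ.suc n} c f g cf≤g = begin
    c * ℕ→ℚ (f zero ℕ.+ sum (f ∘ suc))         ≡⟨ cong (c *_) (ℕ→ℚ-+ (f zero) _) ⟩
    c * (ℕ→ℚ (f zero) + ℕ→ℚ (sum (f ∘ suc)))    ≡⟨ *-distribˡ-+ c _ _ ⟩
    c * ℕ→ℚ (f zero) + c * ℕ→ℚ (sum (f ∘ suc))  ≤⟨ +-mono-≤ (cf≤g zero) (∑-scale-≤ c (f ∘ suc) (g ∘ suc) (cf≤g ∘ suc)) ⟩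
    ℕ→ℚ (g zero) + ℕ→ℚ (sum (g ∘ suc))          ≡⟨ ℕ→ℚ-+ (g zero) _ ⟨
    ℕ→ℚ (g zero ℕ.+ sum (g ∘ suc))              ∎
    where open ≤-Reasoning

module CountsInℚ {p : ℕ} (G : Graph p) where

  open C4Counting G using (S; S+2e≡∑degree²; ∑degree≡2e; S²≤p²[8M+4em²+S])
  open FiniteSums using (∑-const)
  open Embedding
  open import Data.Integer using (+_)
  import Data.Nat as ℕ
  import Data.Nat.Properties as ℕ
  open import Data.Rational using (ℚ; _≤_; _+_; _*_; _/_; nonNegative)
  open import Data.Rational.Properties using (*-identityʳ; *-comm; *-monoʳ-≤-nonNeg)
  open import Algebra.Properties.Semiring.Sum ℕ.+-*-semiring using (sum)

  P q : ℚ
  P = ℕ→ℚ p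
  q = ℕ→ℚ (edges G)

  ∑degree≡2q : ℕ→ℚ (sum (degree G)) ≡ (+ 2) / 1 * q
  ∑degree≡2q = trans (cong ℕ→ℚ ∑degree≡2e) (ℕ→ℚ-* 2 (edges G))

  module _ (λ′ : ℚ) (λp≤degree : ∀ v → λ′ * P ≤ ℕ→ℚ (degree G v)) where

    P·λP≤2q : P * (λ′ * P) ≤ (+ 2) / 1 * q
    P·λP≤2q = subst₂ _≤_ (trans (cong (λ′ * P *_) (cong ℕ→ℚ (trans (∑-const p 1) (ℕ.*-identityʳ p)))) (*-comm (λ′ * P) P))
                         ∑degree≡2q
                         (∑-scale-≤ (λ′ * P) (λ _ → 1) (degree G) λ v → subst (_≤ _) (sym (*-identityʳ (λ′ * P))) (λp≤degree v))

    λP·2q≤S+2q : λ′ * P * ((+ 2) / 1 * q) ≤ ℕ→ℚ S + (+ 2) / 1 * q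
    λP·2q≤S+2q = subst₂ _≤_ (cong (λ′ * P *_) ∑degree≡2q)
                            (trans (cong ℕ→ℚ (sym S+2e≡∑degree²)) (trans (ℕ→ℚ-+ S _) (cong (λ z → ℕ→ℚ S + z) (ℕ→ℚ-* 2 (edges G)))))
                            (∑-scale-≤ (λ′ * P) (degree G) (λ w → degree G w ℕ.* degree G w) λ v →
                               subst (λ′ * P * ℕ→ℚ (degree G v) ≤_) (sym (ℕ→ℚ-* (degree G v) (degree G v)))
                                     (*-monoʳ-≤-nonNeg (ℕ→ℚ (degree G v)) {{nonNegative (0≤ℕ→ℚ (degree G v))}} (λp≤degree v)))

  module _ (m : ℕ) where

    Y : ℕ
    Y = 8 ℕ.* M-C4 G ℕ.+ 4 ℕ.* (edges G ℕ.* (m ℕ.* m))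

    X : ℚ
    X = (+ 8) / 1 * ℕ→ℚ (M-C4 G) + (+ 4) / 1 * (q * (ℕ→ℚ m * ℕ→ℚ m))

    X≡ : ℕ→ℚ Y ≡ X
    X≡ = trans (ℕ→ℚ-+ (8 ℕ.* M-C4 G) (4 ℕ.* (edges G ℕ.* (m ℕ.* m))))
               (cong₂ _+_ (ℕ→ℚ-* 8 (M-C4 G)) (trans (ℕ→ℚ-* 4 (edges G ℕ.* (m ℕ.* m)))
                 (cong ((+ 4) / 1 *_) (trans (ℕ→ℚ-* (edges G) (m ℕ.* m)) (cong (q *_) (ℕ→ℚ-* m m))))))

    S²≤P²[X+S] : bs G ℕ.≤ m → ℕ→ℚ S * ℕ→ℚ S ≤ P * P * (X + ℕ→ℚ S)
    S²≤P²[X+S] bs≤m = subst₂ _≤_ (ℕ→ℚ-* S S)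
                                 (trans (ℕ→ℚ-* (p ℕ.* p) (Y ℕ.+ S)) (cong₂ _*_ (ℕ→ℚ-* p p) (trans (ℕ→ℚ-+ Y S) (cong (_+ ℕ→ℚ S) X≡))))
                                 (ℕ→ℚ-mono-≤ (S²≤p²[8M+4em²+S] bs≤m))

open import Data.Nat using (ℕ; _≤_)
open import Data.Fin using (Fin)
open import Data.Rational using (ℚ; 0ℚ; 1ℚ; _<_; _+_; _*_; _-_; _/_)
open import Data.Integer using (+_)
open RationalBounds using (8λ³p²q/5<X; unscale-by-8)
open CountsInℚ using (P·λP≤2q; λP·2q≤S+2q; S²≤P²[X+S])

lemma1 : (p m : ℕ) (G : Graph p) (lam : ℚ)
    → bs G ≤ m
    → 0ℚ < lam → lam < 1ℚ
    → (∀ (v : Fin p) → lam * ℕ→ℚ p Data.Rational.≤ ℕ→ℚ (degree G v))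
    → ((+ 5) / 1) * (((+ 2) / 1) * lam + 1ℚ) < ℕ→ℚ p * (lam * lam)
    → ((lam * lam * lam * ℕ→ℚ p * ℕ→ℚ p) * ((+ 1) / 5) - (ℕ→ℚ m * ℕ→ℚ m) * ((+ 1) / 2)) * ℕ→ℚ (edges G)
    < ℕ→ℚ (M-C4 G)
lemma1 p m G lam bs≤m 0<lam _ lamp≤degree big-p =
  unscale-by-8 {lam * lam * lam * ℕ→ℚ p * ℕ→ℚ p} {ℕ→ℚ m} {ℕ→ℚ (edges G)} {ℕ→ℚ (M-C4 G)}
    (8λ³p²q/5<X 0<lam big-p (S²≤P²[X+S] G m bs≤m) (λP·2q≤S+2q G lam lamp≤degree) (P·λP≤2q G lam lamp≤degree))
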